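{- Let $M=(m_{ij})_{1\le i,j\le n}$ be an $n\times n$ matrix whose entries are each coloured white or black such that the number of white entries and the number of black entries differ by at most one. Let $c=\frac12-\frac14\sqrt2$ and $m=\lfloor cn\rfloor$. Then at least one of the following holds: (1) one can choose $m$ rows, and in each of these rows one white and one black entry, such that all these $2m$ entries lie in pairwise different columns; (2) one can choose $m$ columns, and in each of these columns one white and one black entry, such that all these $2m$ entries lie in pairwise different rows. -}

module Defs where

open import Data.Nat using (ℕ; zero; suc; _+_; _*_; _∸_; _≤_)
open import Data.Bool using (Bool; true; false)
open import Data.Fin using (Fin)
open import Data.Sum using (_⊎_; [_,_])
open import Data.Product using (_×_; Σ; ∃)
open import Data.List using (List; map; allFin; concatMap)
open import Data.Nat.ListAction using (sum)
open import Relation.Nullary using (¬_)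
open import Relation.Binary.PropositionalEquality using (_≡_)
open import Function.Definitions using (Injective)

Colour : Set
Colour = Bool

white black : Colour
white = true
black = false

Matrix : ℕ → Set
Matrix n = Fin n → Fin n → Colour

transpose : ∀ {n} → Matrix n → Matrix n
transpose M i j = M j i

isWhite : Colour → ℕ
isWhite true = 1
isWhite false = 0

#white : ∀ {n} → Matrix n → ℕ
#white {n} M = sum (concatMap (λ i → map (λ j → isWhite (M i j)) (allFin n)) (allFin n))

#black : ∀ {n} → Matrix n → ℕ
#black {n} M = (n * n) ∸ #white M

Balanced : ∀ {n} → Matrix n → Set
Balanced M = (#white M ≤ #black M + 1) × (#black M ≤ #white M + 1)

-- m ≤ c·n where c = 1/2 - √2/4, i.e. 4m ≤ (2 - √2) n,
-- i.e. 4m ≤ 2n and √2·n ≤ 2n - 4m, i.e. 4m ≤ 2n and 2n² ≤ (2n - 4m)².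
LeCN : ℕ → ℕ → Set
LeCN n m = (4 * m ≤ 2 * n) × (2 * (n * n) ≤ (2 * n ∸ 4 * m) * (2 * n ∸ 4 * m))

IsFloorCN : ℕ → ℕ → Set
IsFloorCN n m = LeCN n m × ¬ LeCN n (suc m)

RowChoice : ∀ {n} → Matrix n → ℕ → Set
RowChoice {n} M m =
  Σ (Fin m → Fin n) λ r →
  Σ (Fin m → Fin n) λ w →
  Σ (Fin m → Fin n) λ b →
    Injective _≡_ _≡_ r
    × (∀ k → M (r k) (w k) ≡ white)
    × (∀ k → M (r k) (b k) ≡ black)
    × Injective _≡_ _≡_ [ w , b ]

ColumnChoice : ∀ {n} → Matrix n → ℕ → Set
ColumnChoice {n} M m =
  Σ (Fin m → Fin n) λ c →
  Σ (Fin m → Fin n) λ w →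
  Σ (Fin m → Fin n) λ b →
    Injective _≡_ _≡_ c
    × (∀ k → M (w k) (c k) ≡ white)
    × (∀ k → M (b k) (c k) ≡ black)
    × Injective _≡_ _≡_ [ w , b ]

module Submission where

-- Run the greedy procedure: as long as some remaining row has a
-- white and a black entry in two remaining columns, record that row with
-- those two entries and delete the row and both columns.  If this succeeds
-- m times we have option (1).  Otherwise it stops after ℓ < m steps with
-- n - ℓ rows and n - 2ℓ columns left in which every row is monochromatic.
-- Writing n = 2m + d, the bound m ≤ cn says n² ≤ 2d²; in particular m ≤ d
-- and at least d + 2 columns are left.  Split the remaining rows by colour.
-- A class with at least d + 2 rows would give a monochromatic rectangle of
-- (d + 2)² > (n² + 1)/2 entries, too many for a balanced colouring, so
-- both classes have at least m rows, and m columns together with m rows of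
-- each class give option (2).

open import Defs
open import Data.Nat using (ℕ; zero; suc; _+_; _*_; _∸_; _≤_; _<_; z≤n; s≤s)
open import Data.Nat.Properties hiding (suc-injective)
open import Data.Nat.Tactic.RingSolver using (solve-∀)
open import Data.Nat.ListAction using () renaming (sum to listSum)
open import Data.Nat.ListAction.Properties using (sum-++)
open import Data.Bool using (true; false; not)
open import Data.Bool.Properties using () renaming (_≟_ to _≟ᶜ_)
open import Data.Fin using (Fin; zero; suc; punchIn; punchOut; inject≤; fromℕ<)
open import Data.Fin.Properties
  using (suc-injective; punchIn-injective; punchInᵢ≢i; punchOut-injective; punchIn-punchOut; inject≤-injective; any?)
open import Data.Vec.Functional using (_∷_)
import Data.List as L
open import Data.List.Properties using (map-tabulate)
open import Data.Product using (Σ; ∃-syntax; _×_; _,_; proj₁; proj₂)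
open import Data.Sum using (_⊎_; inj₁; inj₂; [_,_])
import Data.Sum as Sum
open import Data.Sum.Properties using (inj₁-injective; inj₂-injective)
open import Data.Empty using (⊥)
open import Function using (_∘_; id)
open import Function.Definitions using (Injective)
open import Relation.Nullary using (¬_; Dec; yes; no; contradiction)
open import Relation.Nullary.Decidable using (map′; _×-dec_)
open import Relation.Binary.PropositionalEquality hiding ([_])
open import Algebra.Properties.CommutativeMonoid.Sum +-0-commutativeMonoid
  using (sum; sum-syntax; sum-remove; sum-cong-≗; ∑-distrib-+)

∑-const : ∀ n c → ∑[ i < n ] c ≡ n * c
∑-const zero    c = refl
∑-const (suc n) c = cong (c +_) (∑-const n c)

∑-mono : ∀ {n} {f g : Fin n → ℕ} → (∀ i → f i ≤ g i) → sum f ≤ sum g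
∑-mono {zero}  f≤g = z≤n
∑-mono {suc n} f≤g = +-mono-≤ (f≤g zero) (∑-mono (f≤g ∘ suc))

-- Induction on the domain: pull ρ 0 out of the full sum (sum-remove) and
-- view the rest of ρ as an injection avoiding ρ 0 via punchOut.
∑-injective-≤ : ∀ {a n} (f : Fin n → ℕ) {ρ : Fin a → Fin n} →
                Injective _≡_ _≡_ ρ → sum (f ∘ ρ) ≤ sum f
∑-injective-≤ {zero}          f     ρ-inj = z≤n
∑-injective-≤ {suc a} {zero}  f {ρ} ρ-inj with ρ zero
... | ()
∑-injective-≤ {suc a} {suc n} f {ρ} ρ-inj = begin
  f ρ₀ + sum (f ∘ ρ ∘ suc)              ≡⟨ cong (f ρ₀ +_) (sum-cong-≗ (cong f ∘ punchIn-punchOut ∘ fresh)) ⟨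
  f ρ₀ + sum (f ∘ punchIn ρ₀ ∘ rest)    ≤⟨ +-monoʳ-≤ (f ρ₀) (∑-injective-≤ (f ∘ punchIn ρ₀) rest-injective) ⟩
  f ρ₀ + sum (f ∘ punchIn ρ₀)           ≡⟨ sum-remove f ⟨
  sum f                                 ∎
  where
  open ≤-Reasoning
  ρ₀ = ρ zero
  fresh : ∀ x → ρ₀ ≢ ρ (suc x)
  fresh x e with ρ-inj e
  ... | ()
  rest : Fin a → Fin n
  rest x = punchOut (fresh x)
  rest-injective : Injective _≡_ _≡_ rest
  rest-injective {x} {y} = suc-injective ∘ ρ-inj ∘ punchOut-injective (fresh x) (fresh y)

listSum-tabulate : ∀ {n} (f : Fin n → ℕ) → listSum (L.tabulate f) ≡ sum f
listSum-tabulate {zero}  f = refl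
listSum-tabulate {suc n} f = cong (f zero +_) (listSum-tabulate (f ∘ suc))

listSum-allFin : ∀ {n} (f : Fin n → ℕ) → listSum (L.map f (L.allFin n)) ≡ sum f
listSum-allFin f = trans (cong listSum (map-tabulate id f)) (listSum-tabulate f)

listSum-concatMap : ∀ {A : Set} (g : A → L.List ℕ) xs →
                    listSum (L.concatMap g xs) ≡ listSum (L.map (listSum ∘ g) xs)
listSum-concatMap g L.[]       = refl
listSum-concatMap g (x L.∷ xs) =
  trans (sum-++ (g x) (L.concatMap g xs)) (cong (listSum (g x) +_) (listSum-concatMap g xs))

matches : Colour → Colour → ℕ
matches true  x = isWhite x
matches false x = isWhite (not x)

matches-self : ∀ c → matches c c ≡ 1
matches-self true  = refl
matches-self false = refl

matches-total : ∀ x → matches white x + matches black x ≡ 1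
matches-total true  = refl
matches-total false = refl

#colour : ∀ {n} → Colour → Matrix n → ℕ
#colour {n} c M = ∑[ i < n ] ∑[ j < n ] matches c (M i j)

#white≡#colour : ∀ {n} (M : Matrix n) → #white M ≡ #colour white M
#white≡#colour {n} M = begin
  #white M                                          ≡⟨ listSum-concatMap rowList (L.allFin n) ⟩
  listSum (L.map (listSum ∘ rowList) (L.allFin n))  ≡⟨ listSum-allFin (listSum ∘ rowList) ⟩
  ∑[ i < n ] listSum (rowList i)                    ≡⟨ sum-cong-≗ {n} (λ i → listSum-allFin (isWhite ∘ M i)) ⟩
  #colour white M                                   ∎
  where
  open ≡-Reasoning
  rowList : Fin n → L.List ℕ
  rowList i = L.map (λ j → isWhite (M i j)) (L.allFin n)

-- Every entry has exactly one of the two colours.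
#colour-total : ∀ {n} (M : Matrix n) → #colour white M + #colour black M ≡ n * n
#colour-total {n} M = begin
  #colour white M + #colour black M                                 ≡⟨ ∑-distrib-+ (row white) (row black) ⟨
  ∑[ i < n ] (∑[ j < n ] matches white (M i j) + ∑[ j < n ] matches black (M i j))
                                                                    ≡⟨ sum-cong-≗ {n} (λ i → ∑-distrib-+ (matches white ∘ M i) (matches black ∘ M i)) ⟨
  ∑[ i < n ] ∑[ j < n ] (matches white (M i j) + matches black (M i j))
                                                                    ≡⟨ sum-cong-≗ {n} (λ i → sum-cong-≗ {n} (matches-total ∘ M i)) ⟩
  ∑[ i < n ] ∑[ j < n ] 1                                           ≡⟨ sum-cong-≗ {n} (λ i → trans (∑-const n 1) (*-identityʳ n)) ⟩
  ∑[ i < n ] n                                                      ≡⟨ ∑-const n n ⟩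
  n * n                                                             ∎
  where
  open ≡-Reasoning
  row : Colour → Fin n → ℕ
  row c i = ∑[ j < n ] matches c (M i j)

#black≡#colour : ∀ {n} (M : Matrix n) → #black M ≡ #colour black M
#black≡#colour {n} M = begin
  n * n ∸ #white M                                   ≡⟨ cong (n * n ∸_) (#white≡#colour M) ⟩
  n * n ∸ #colour white M                            ≡⟨ cong (_∸ #colour white M) (#colour-total M) ⟨
  #colour white M + #colour black M ∸ #colour white M ≡⟨ m+n∸m≡n (#colour white M) (#colour black M) ⟩
  #colour black M                                    ∎
  where open ≡-Reasoning

half-bound : ∀ {x y N} → x + y ≡ N → x ≤ y + 1 → 2 * x ≤ N + 1
half-bound {x} {y} {N} x+y≡N x≤y+1 = begin
  2 * x        ≡⟨ cong (x +_) (+-identityʳ x) ⟩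
  x + x        ≤⟨ +-monoʳ-≤ x x≤y+1 ⟩
  x + (y + 1)  ≡⟨ +-assoc x y 1 ⟨
  x + y + 1    ≡⟨ cong (_+ 1) x+y≡N ⟩
  N + 1        ∎
  where open ≤-Reasoning

balanced-bound : ∀ {n} {M : Matrix n} → Balanced M → ∀ c → 2 * #colour c M ≤ n * n + 1
balanced-bound {n} {M} (w≤b+1 , b≤w+1) true  =
  half-bound (#colour-total M) (subst₂ (λ w b → w ≤ b + 1) (#white≡#colour M) (#black≡#colour M) w≤b+1)
balanced-bound {n} {M} (w≤b+1 , b≤w+1) false =
  half-bound (trans (+-comm (#colour black M) (#colour white M)) (#colour-total M))
             (subst₂ (λ b w → b ≤ w + 1) (#black≡#colour M) (#white≡#colour M) b≤w+1)

rectangle-≤ : ∀ {n a b} (M : Matrix n) (c : Colour) {ρ : Fin a → Fin n} {γ : Fin b → Fin n} →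
              Injective _≡_ _≡_ ρ → Injective _≡_ _≡_ γ →
              (∀ x y → M (ρ x) (γ y) ≡ c) → a * b ≤ #colour c M
rectangle-≤ {n} {a} {b} M c {ρ} {γ} ρ-inj γ-inj coloured = begin
  a * b                                             ≡⟨ ∑-const a b ⟨
  ∑[ x < a ] b                                      ≡⟨ sum-cong-≗ {a} (λ x → trans (∑-const b 1) (*-identityʳ b)) ⟨
  ∑[ x < a ] ∑[ y < b ] 1                           ≡⟨ sum-cong-≗ {a} (λ x → sum-cong-≗ {b} (entry x)) ⟨
  ∑[ x < a ] ∑[ y < b ] matches c (M (ρ x) (γ y))   ≤⟨ ∑-mono (λ x → ∑-injective-≤ (matches c ∘ M (ρ x)) γ-inj) ⟩
  ∑[ x < a ] ∑[ j < n ] matches c (M (ρ x) j)       ≤⟨ ∑-injective-≤ (λ i → ∑[ j < n ] matches c (M i j)) ρ-inj ⟩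
  #colour c M                                       ∎
  where
  open ≤-Reasoning
  entry : ∀ x y → matches c (M (ρ x) (γ y)) ≡ 1
  entry x y = trans (cong (matches c) (coloured x y)) (matches-self c)

-- A balanced matrix with n² ≤ 2d² has no monochromatic (d + 2) × (d + 2)
-- rectangle: twice its size, 2(d + 2)², exceeds 2d² + 1 ≥ n² + 1.
no-large-monochromatic-rectangle :
  ∀ {n d a b} {M : Matrix n} → Balanced M → n * n ≤ 2 * (d * d) →
  (c : Colour) {ρ : Fin a → Fin n} {γ : Fin b → Fin n} →
  Injective _≡_ _≡_ ρ → Injective _≡_ _≡_ γ → (∀ x y → M (ρ x) (γ y) ≡ c) →
  d + 2 ≤ a → d + 2 ≤ b → ⊥
no-large-monochromatic-rectangle {n} {d} {a} {b} {M} bal n²≤2d² c ρ-inj γ-inj coloured a-large b-large =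
  m+1+n≰m (2 * (d * d) + 1) (begin
    2 * (d * d) + 1 + suc (8 * d + 6)  ≡⟨ expand d ⟩
    2 * ((d + 2) * (d + 2))            ≤⟨ *-monoʳ-≤ 2 (*-mono-≤ a-large b-large) ⟩
    2 * (a * b)                        ≤⟨ *-monoʳ-≤ 2 (rectangle-≤ M c ρ-inj γ-inj coloured) ⟩
    2 * #colour c M                    ≤⟨ balanced-bound {n} {M} bal c ⟩
    n * n + 1                          ≤⟨ +-monoˡ-≤ 1 n²≤2d² ⟩
    2 * (d * d) + 1                    ∎)
  where
  open ≤-Reasoning
  expand : ∀ d → 2 * (d * d) + 1 + suc (8 * d + 6) ≡ 2 * ((d + 2) * (d + 2))
  expand = solve-∀

-- m ≤ cn means: n = 2m + d with n² ≤ 2d² (the definition squares 2n - 4m = 2d).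
floor-gap : ∀ {n m} → LeCN n m → ∃[ d ] (n ≡ 2 * m + d × n * n ≤ 2 * (d * d))
floor-gap {n} {m} (4m≤2n , 2n²≤[2n∸4m]²) =
  d , sym (m+[n∸m]≡n 2m≤n) , *-cancelˡ-≤ 2 (begin
    2 * (n * n)                        ≤⟨ 2n²≤[2n∸4m]² ⟩
    (2 * n ∸ 4 * m) * (2 * n ∸ 4 * m)  ≡⟨ cong (λ x → x * x) 2n∸4m≡2d ⟩
    (2 * d) * (2 * d)                  ≡⟨ regroup d ⟩
    2 * (2 * (d * d))                  ∎)
  where
  open ≤-Reasoning
  2m≤n : 2 * m ≤ n
  2m≤n = *-cancelˡ-≤ 2 (subst (_≤ 2 * n) (*-assoc 2 2 m) 4m≤2n)
  d : ℕ
  d = n ∸ 2 * m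
  2n∸4m≡2d : 2 * n ∸ 4 * m ≡ 2 * d
  2n∸4m≡2d = trans (cong (2 * n ∸_) (*-assoc 2 2 m)) (sym (*-distribˡ-∸ 2 n (2 * m)))
  regroup : ∀ d → (2 * d) * (2 * d) ≡ 2 * (2 * (d * d))
  regroup = solve-∀

-- n² ≤ 2d² forces n ≤ 2d, hence 2m ≤ d and in particular m ≤ d.
m≤d : ∀ {n m d} → n ≡ 2 * m + d → n * n ≤ 2 * (d * d) → m ≤ d
m≤d {n} {m} {d} n≡2m+d n²≤2d² =
  ≤-trans (m≤n*m m 2) (+-cancelʳ-≤ d (2 * m) d (begin
    2 * m + d  ≡⟨ n≡2m+d ⟨
    n          ≤⟨ n≤2d ⟩
    2 * d      ≡⟨ cong (d +_) (+-identityʳ d) ⟩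
    d + d      ∎))
  where
  open ≤-Reasoning
  2d²≤[2d]² : 2 * (d * d) ≤ (2 * d) * (2 * d)
  2d²≤[2d]² = ≤-trans (m≤m+n (2 * (d * d)) (2 * (d * d))) (≤-reflexive (double d))
    where
    double : ∀ d → 2 * (d * d) + 2 * (d * d) ≡ (2 * d) * (2 * d)
    double = solve-∀
  n≤2d : n ≤ 2 * d
  n≤2d = ≮⇒≥ λ 2d<n → <⇒≱ (*-mono-< 2d<n 2d<n) (≤-trans n²≤2d² 2d²≤[2d]²)

spare : ∀ {n m d c x y} → n ≡ 2 * m + d → n ≤ c + (x + y) → x < m → y < m → d + 2 ≤ c
spare {n} {m} {d} {c} {x} {y} n≡2m+d n≤c+x+y x<m y<m = +-cancelʳ-≤ (m + m) (d + 2) c (begin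
  d + 2 + (m + m)        ≡⟨ regroup m d ⟩
  2 * m + d + 2          ≡⟨ cong (_+ 2) n≡2m+d ⟨
  n + 2                  ≤⟨ +-monoˡ-≤ 2 n≤c+x+y ⟩
  c + (x + y) + 2        ≡⟨ shift c x y ⟩
  c + (suc x + suc y)    ≤⟨ +-monoʳ-≤ c (+-mono-≤ x<m y<m) ⟩
  c + (m + m)            ∎)
  where
  open ≤-Reasoning
  regroup : ∀ m d → d + 2 + (m + m) ≡ 2 * m + d + 2
  regroup = solve-∀
  shift : ∀ c x y → c + (x + y) + 2 ≡ c + (suc x + suc y)
  shift = solve-∀

Disjoint : ∀ {a b} {X : Set} → (Fin a → X) → (Fin b → X) → Set
Disjoint f g = ∀ x y → f x ≢ g y

[,]-injective : ∀ {a b} {X : Set} {f : Fin a → X} {g : Fin b → X} →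
                Injective _≡_ _≡_ f → Injective _≡_ _≡_ g → Disjoint f g →
                Injective _≡_ _≡_ [ f , g ]
[,]-injective f-inj g-inj f#g {inj₁ x} {inj₁ y} e = cong inj₁ (f-inj e)
[,]-injective f-inj g-inj f#g {inj₁ x} {inj₂ y} e = contradiction e (f#g x y)
[,]-injective f-inj g-inj f#g {inj₂ x} {inj₁ y} e = contradiction (sym e) (f#g y x)
[,]-injective f-inj g-inj f#g {inj₂ x} {inj₂ y} e = cong inj₂ (g-inj e)

[,]-injective⁻ : ∀ {a b} {X : Set} {f : Fin a → X} {g : Fin b → X} → Injective _≡_ _≡_ [ f , g ] →
                 Injective _≡_ _≡_ f × Injective _≡_ _≡_ g × Disjoint f g
[,]-injective⁻ fg-inj = inj₁-injective ∘ fg-inj , inj₂-injective ∘ fg-inj , λ x y e → inj₁≢inj₂ (fg-inj {inj₁ x} {inj₂ y} e)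
  where
  inj₁≢inj₂ : ∀ {x y} → inj₁ x ≢ inj₂ y
  inj₁≢inj₂ ()

∷-injective : ∀ {k} {X : Set} {f : Fin k → X} {y : X} →
              Injective _≡_ _≡_ f → (∀ t → f t ≢ y) → Injective _≡_ _≡_ (y ∷ f)
∷-injective f-inj fresh {zero}  {zero}  e = refl
∷-injective f-inj fresh {zero}  {suc t} e = contradiction (sym e) (fresh t)
∷-injective f-inj fresh {suc s} {zero}  e = contradiction e (fresh s)
∷-injective f-inj fresh {suc s} {suc t} e = cong suc (f-inj e)

∷-disjoint : ∀ {a b} {X : Set} {f : Fin a → X} {g : Fin b → X} {y y' : X} → y ≢ y' →
             (∀ t → f t ≢ y') → (∀ t → g t ≢ y) → Disjoint f g → Disjoint (y ∷ f) (y' ∷ g)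
∷-disjoint y≢y' f-fresh g-fresh f#g zero    zero    = y≢y'
∷-disjoint y≢y' f-fresh g-fresh f#g zero    (suc t) = g-fresh t ∘ sym
∷-disjoint y≢y' f-fresh g-fresh f#g (suc s) zero    = f-fresh s
∷-disjoint y≢y' f-fresh g-fresh f#g (suc s) (suc t) = f#g s t

Grid : ℕ → ℕ → Set
Grid p q = Fin p → Fin q → Colour

_ᵀ : ∀ {p q} → Grid p q → Grid q p
(A ᵀ) j i = A i j

-- k distinct rows of A, each with a white and a black entry, the 2k entries
-- in distinct columns.  RowChoice M k is Choice M k and ColumnChoice M k is
-- Choice (M ᵀ) k.
Choice : ∀ {p q} → Grid p q → ℕ → Set
Choice {p} {q} A k =
  Σ (Fin k → Fin p) λ r →
  Σ (Fin k → Fin q) λ w →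
  Σ (Fin k → Fin q) λ b →
    Injective _≡_ _≡_ r
    × (∀ t → A (r t) (w t) ≡ white)
    × (∀ t → A (r t) (b t) ≡ black)
    × Injective _≡_ _≡_ [ w , b ]

no-rows : ∀ {p q} {A : Grid p q} → Choice A 0
no-rows = (λ ()) , (λ ()) , (λ ()) , (λ { {()} }) , (λ ()) , (λ ()) , λ { {inj₁ ()} ; {inj₂ ()} }

record Cross {p q} (A : Grid p q) : Set where
  constructor cross
  field
    i         : Fin p
    j j'      : Fin q
    white-ij  : A i j ≡ white
    black-ij' : A i j' ≡ black

  j≢j' : j ≢ j'
  j≢j' j≡j' with trans (sym white-ij) (trans (cong (A i) j≡j') black-ij')
  ... | ()

choice-cons : ∀ {p q k} {A : Grid p q} (x : Cross A) → let open Cross x in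
              (c : Choice A k) → let (r , w , b , _) = c in
              (∀ t → r t ≢ i) → (∀ t → w t ≢ j × w t ≢ j') → (∀ t → b t ≢ j × b t ≢ j') →
              Choice A (suc k)
choice-cons x@(cross i j j' white-ij black-ij') (r , w , b , r-inj , w-white , b-black , wb-inj) r-fresh w-fresh b-fresh =
  let w-inj , b-inj , w#b = [,]-injective⁻ wb-inj in
  i ∷ r , j ∷ w , j' ∷ b , ∷-injective r-inj r-fresh ,
  (λ { zero → white-ij ; (suc t) → w-white t }) ,
  (λ { zero → black-ij' ; (suc t) → b-black t }) ,
  [,]-injective (∷-injective w-inj (proj₁ ∘ w-fresh)) (∷-injective b-inj (proj₂ ∘ b-fresh))
                (∷-disjoint (Cross.j≢j' x) (proj₂ ∘ w-fresh) (proj₁ ∘ b-fresh) w#b)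

record Selection (p q : ℕ) : Set where
  field
    rows cols     : ℕ
    row           : Fin rows → Fin p
    col           : Fin cols → Fin q
    row-injective : Injective _≡_ _≡_ row
    col-injective : Injective _≡_ _≡_ col

open Selection

_↾_ : ∀ {p q} → Grid p q → (s : Selection p q) → Grid (rows s) (cols s)
(A ↾ s) x y = A (row s x) (col s y)

_⨾_ : ∀ {p q} (s : Selection p q) → Selection (rows s) (cols s) → Selection p q
s ⨾ t = record
  { rows = rows t ; cols = cols t
  ; row = row s ∘ row t ; col = col s ∘ col t
  ; row-injective = row-injective t ∘ row-injective s
  ; col-injective = col-injective t ∘ col-injective s }

-- The same selection seen in the transposed grid: (A ↾ s) ᵀ = A ᵀ ↾ s ᵀˢ.
_ᵀˢ : ∀ {p q} → Selection p q → Selection q p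
s ᵀˢ = record
  { rows = cols s ; cols = rows s ; row = col s ; col = row s
  ; row-injective = col-injective s ; col-injective = row-injective s }

choice-lift : ∀ {p q k} {A : Grid p q} (s : Selection p q) → Choice (A ↾ s) k → Choice A k
choice-lift s (r , w , b , r-inj , w-white , b-black , wb-inj) =
  let w-inj , b-inj , w#b = [,]-injective⁻ wb-inj in
  row s ∘ r , col s ∘ w , col s ∘ b , r-inj ∘ row-injective s , w-white , b-black ,
  [,]-injective (w-inj ∘ col-injective s) (b-inj ∘ col-injective s) (λ x y → w#b x y ∘ col-injective s)

record Deletion {p q} (i : Fin p) (j j' : Fin q) : Set where
  field
    selection : Selection p q
    rows-left : p ≤ suc (rows selection)
    cols-left : q ≤ 2 + cols selection
    row-fresh : ∀ x → row selection x ≢ i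
    col-fresh : ∀ y → col selection y ≢ j × col selection y ≢ j'

-- Built from punchIn: columns skip j, and then the position of j' among the rest.
delete : ∀ {p q} (i : Fin p) {j j' : Fin q} → j ≢ j' → Deletion i j j'
delete {suc p} {zero} i {()}
delete {suc p} {suc zero} i {zero} {zero} j≢j' = contradiction refl j≢j'
delete {suc p} {suc (suc q)} i {j} {j'} j≢j' = record
  { selection = record
      { rows = p ; cols = q ; row = punchIn i ; col = punchIn j ∘ punchIn j₁
      ; row-injective = punchIn-injective i _ _
      ; col-injective = punchIn-injective j₁ _ _ ∘ punchIn-injective j _ _ }
  ; rows-left = ≤-refl
  ; cols-left = ≤-refl
  ; row-fresh = punchInᵢ≢i i
  ; col-fresh = λ y → punchInᵢ≢i j (punchIn j₁ y)
                     , λ e → punchInᵢ≢i j₁ y (punchIn-injective j _ _ (trans e (sym j'-position))) }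
  where
  j₁ : Fin (suc q)
  j₁ = punchOut j≢j'
  j'-position : punchIn j j₁ ≡ j'
  j'-position = punchIn-punchOut j≢j'

RowsMonochromatic : ∀ {p q} → Grid p q → Set
RowsMonochromatic A = ∀ i j j' → A i j ≡ A i j'

no-cross⇒monochromatic : ∀ {p q} {A : Grid p q} → ¬ Cross A → RowsMonochromatic A
no-cross⇒monochromatic {A = A} no-cross i j j' with A i j in e | A i j' in e'
... | true  | true  = refl
... | false | false = refl
... | true  | false = contradiction (cross i j j' e e') no-cross
... | false | true  = contradiction (cross i j' j e' e) no-cross

cross? : ∀ {p q} (A : Grid p q) → Dec (Cross A)
cross? A = map′ (λ (i , j , j' , e , e') → cross i j j' e e')
                (λ (cross i j j' e e') → i , j , j' , e , e')
                (any? λ i → any? λ j → any? λ j' → (A i j ≟ᶜ white) ×-dec (A i j' ≟ᶜ black))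

-- The greedy procedure got stuck after ℓ steps: at most ℓ rows and 2ℓ
-- columns are deleted and every remaining row is monochromatic.
record Stuck {p q} (A : Grid p q) (ℓ : ℕ) : Set where
  field
    selection     : Selection p q
    rows-left     : p ≤ rows selection + ℓ
    cols-left     : q ≤ cols selection + (ℓ + ℓ)
    monochromatic : RowsMonochromatic (A ↾ selection)

stuck-now : ∀ {p q} {A : Grid p q} → RowsMonochromatic A → Stuck A 0
stuck-now {p} {q} mono = record
  { selection = record
      { rows = p ; cols = q ; row = id ; col = id ; row-injective = id ; col-injective = id }
  ; rows-left = ≤-reflexive (sym (+-identityʳ p))
  ; cols-left = ≤-reflexive (sym (+-identityʳ q))
  ; monochromatic = mono }

stuck-after : ∀ {p q ℓ} {A : Grid p q} {i j j'} (d : Deletion i j j') →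
              Stuck (A ↾ Deletion.selection d) ℓ → Stuck A (suc ℓ)
stuck-after {ℓ = ℓ} d st = record
  { selection = D.selection ⨾ S.selection
  ; rows-left = ≤-trans D.rows-left (≤-trans (s≤s S.rows-left) (≤-reflexive (sym (+-suc _ ℓ))))
  ; cols-left = ≤-trans D.cols-left (≤-trans (+-monoʳ-≤ 2 S.cols-left) (≤-reflexive (shift (cols S.selection) ℓ)))
  ; monochromatic = S.monochromatic }
  where
  module D = Deletion d
  module S = Stuck st
  shift : ∀ c ℓ → 2 + (c + (ℓ + ℓ)) ≡ c + (suc ℓ + suc ℓ)
  shift = solve-∀

greedy : ∀ k {p q} (A : Grid p q) → Choice A k ⊎ ∃[ ℓ ] (ℓ < k × Stuck A ℓ)
greedy zero    A = inj₁ (no-rows {A = A})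
greedy (suc k) A with cross? A
... | no  no-cross = inj₂ (0 , s≤s z≤n , stuck-now (no-cross⇒monochromatic no-cross))
... | yes x        = Sum.map extend (λ (ℓ , ℓ<k , st) → suc ℓ , s≤s ℓ<k , stuck-after d st)
                             (greedy k (A ↾ selection))
  where
  open Cross x
  d = delete i j≢j'
  open Deletion d
  extend : Choice (A ↾ selection) k → Choice A (suc k)
  extend c@(r , w , b , _) = choice-cons x (choice-lift {A = A} selection c) (row-fresh ∘ r) (col-fresh ∘ w) (col-fresh ∘ b)

record ColourSplit {p} (P : Fin p → Colour) : Set where
  field
    #whites #blacks  : ℕ
    whites           : Fin #whites → Fin p
    blacks           : Fin #blacks → Fin p
    whites-injective : Injective _≡_ _≡_ whites
    blacks-injective : Injective _≡_ _≡_ blacks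
    disjoint         : Disjoint whites blacks
    whites-white     : ∀ x → P (whites x) ≡ white
    blacks-black     : ∀ y → P (blacks y) ≡ black
    size             : #whites + #blacks ≡ p

add-white : ∀ {p} {P : Fin (suc p) → Colour} → P zero ≡ white → ColourSplit (P ∘ suc) → ColourSplit P
add-white white₀ s = record
  { whites = zero ∷ suc ∘ whites ; blacks = suc ∘ blacks
  ; whites-injective = ∷-injective (whites-injective ∘ suc-injective) (λ _ ())
  ; blacks-injective = blacks-injective ∘ suc-injective
  ; disjoint = λ { zero y () ; (suc x) y → disjoint x y ∘ suc-injective }
  ; whites-white = λ { zero → white₀ ; (suc x) → whites-white x }
  ; blacks-black = blacks-black
  ; size = cong suc size }
  where open ColourSplit s

add-black : ∀ {p} {P : Fin (suc p) → Colour} → P zero ≡ black → ColourSplit (P ∘ suc) → ColourSplit P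
add-black black₀ s = record
  { whites = suc ∘ whites ; blacks = zero ∷ suc ∘ blacks
  ; whites-injective = whites-injective ∘ suc-injective
  ; blacks-injective = ∷-injective (blacks-injective ∘ suc-injective) (λ _ ())
  ; disjoint = λ { x zero () ; x (suc y) → disjoint x y ∘ suc-injective }
  ; whites-white = whites-white
  ; blacks-black = λ { zero → black₀ ; (suc y) → blacks-black y }
  ; size = trans (+-suc #whites #blacks) (cong suc size) }
  where open ColourSplit s

split-by-colour : ∀ {p} (P : Fin p → Colour) → ColourSplit P
split-by-colour {zero}  P = record
  { #whites = 0 ; #blacks = 0 ; whites = λ () ; blacks = λ ()
  ; whites-injective = λ { {()} } ; blacks-injective = λ { {()} } ; disjoint = λ ()
  ; whites-white = λ () ; blacks-black = λ () ; size = refl }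
split-by-colour {suc p} P with P zero in e
... | true  = add-white e (split-by-colour (P ∘ suc))
... | false = add-black e (split-by-colour (P ∘ suc))

column-choice : ∀ {p q m} (A : Grid p q) → RowsMonochromatic A → (g : Fin q) →
                (s : ColourSplit (λ i → A i g)) → let open ColourSplit s in
                m ≤ #whites → m ≤ #blacks → m ≤ q → Choice (A ᵀ) m
column-choice A mono g s m≤#whites m≤#blacks m≤q =
  (λ t → inject≤ t m≤q) , whites ∘ first m≤#whites , blacks ∘ first m≤#blacks ,
  inject≤-injective m≤q m≤q _ _ ,
  (λ t → trans (mono _ _ g) (whites-white (first m≤#whites t))) ,
  (λ t → trans (mono _ _ g) (blacks-black (first m≤#blacks t))) ,
  [,]-injective (inject≤-injective m≤#whites m≤#whites _ _ ∘ whites-injective)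
                (inject≤-injective m≤#blacks m≤#blacks _ _ ∘ blacks-injective)
                (λ x y → disjoint (first m≤#whites x) (first m≤#blacks y))
  where
  open ColourSplit s
  first : ∀ {m a} → m ≤ a → Fin m → Fin a
  first m≤a t = inject≤ t m≤a

-- When the greedy procedure is stuck after ℓ < m steps with d + 2 columns
-- left, both colour classes of the remaining rows have at least m rows:
-- otherwise the other class has d + 2 rows and, with the remaining columns,
-- spans a monochromatic rectangle that a balanced matrix cannot have.
classes-large : ∀ {n m d ℓ} {M : Matrix n} → Balanced M → n ≡ 2 * m + d → n * n ≤ 2 * (d * d) →
                ℓ < m → (st : Stuck M ℓ) → let open Stuck st in
                d + 2 ≤ cols selection → (g : Fin (cols selection)) →
                (s : ColourSplit (λ i → (M ↾ selection) i g)) → let open ColourSplit s in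
                m ≤ #whites × m ≤ #blacks
classes-large {n} {m} {d} {ℓ} {M} bal n≡2m+d n²≤2d² ℓ<m st columns-large g s =
  ≮⇒≥ (λ few-whites → class-small black blacks-injective blacks-black
         (spare n≡2m+d (rows-bound #whites #blacks size) few-whites ℓ<m)) ,
  ≮⇒≥ (λ few-blacks → class-small white whites-injective whites-white
         (spare n≡2m+d (rows-bound #blacks #whites (trans (+-comm #blacks #whites) size)) few-blacks ℓ<m))
  where
  open Stuck st
  open ColourSplit s

  class-small : ∀ {a} (c : Colour) {f : Fin a → Fin (rows selection)} → Injective _≡_ _≡_ f →
                (∀ x → (M ↾ selection) (f x) g ≡ c) → d + 2 ≤ a → ⊥
  class-small c f-inj f-coloured a-large =
    no-large-monochromatic-rectangle {d = d} bal n²≤2d² c (f-inj ∘ row-injective selection) (col-injective selection)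
      (λ x y → trans (monochromatic _ y g) (f-coloured x)) a-large columns-large

  rows-bound : ∀ a b → a + b ≡ rows selection → n ≤ b + (a + ℓ)
  rows-bound a b a+b≡rows = ≤-trans rows-left (≤-reflexive (begin
    rows selection + ℓ  ≡⟨ cong (_+ ℓ) a+b≡rows ⟨
    a + b + ℓ           ≡⟨ cong (_+ ℓ) (+-comm a b) ⟩
    b + a + ℓ           ≡⟨ +-assoc b a ℓ ⟩
    b + (a + ℓ)         ∎))
    where open ≡-Reasoning

-- If the greedy procedure gets stuck after ℓ < m steps, option (2) holds:
-- at least d + 2 ≥ m columns remain, and each colour class of the remaining
-- rows is large enough.
columns-when-stuck : ∀ {n m d ℓ} (M : Matrix n) → Balanced M → n ≡ 2 * m + d → n * n ≤ 2 * (d * d) →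
                     ℓ < m → Stuck M ℓ → ColumnChoice M m
columns-when-stuck {n} {m} {d} M bal n≡2m+d n²≤2d² ℓ<m st =
  choice-lift {A = M ᵀ} (selection ᵀˢ)
    (column-choice (M ↾ selection) monochromatic g classes enough-whites enough-blacks enough-columns)
  where
  open Stuck st
  columns-large : d + 2 ≤ cols selection
  columns-large = spare n≡2m+d cols-left ℓ<m ℓ<m

  enough-columns : m ≤ cols selection
  enough-columns = ≤-trans (m≤d n≡2m+d n²≤2d²) (≤-trans (m≤m+n d 2) columns-large)

  g : Fin (cols selection)
  g = fromℕ< (≤-trans (s≤s z≤n) (≤-trans (m≤n+m 2 d) columns-large))

  classes : ColourSplit (λ i → (M ↾ selection) i g)
  classes = split-by-colour (λ i → (M ↾ selection) i g)

  enough-whites : m ≤ ColourSplit.#whites classes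
  enough-whites = proj₁ (classes-large bal n≡2m+d n²≤2d² ℓ<m st columns-large g classes)
  enough-blacks : m ≤ ColourSplit.#blacks classes
  enough-blacks = proj₂ (classes-large bal n≡2m+d n²≤2d² ℓ<m st columns-large g classes)

lemma1 : (n m : ℕ) (M : Matrix n) → Balanced M → IsFloorCN n m → RowChoice M m ⊎ ColumnChoice M m
lemma1 n m M bal (m≤cn , _) with greedy m M
... | inj₁ rows-chosen       = inj₁ rows-chosen
... | inj₂ (ℓ , ℓ<m , stuck) =
  let d , n≡2m+d , n²≤2d² = floor-gap {n} {m} m≤cn in
  inj₂ (columns-when-stuck M bal n≡2m+d n²≤2d² ℓ<m stuck)
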